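{- For every integer $n\geq 1$, $$\sum_{k=1}^n H_k(1,1,1)=(n+1)H_n(1,1,1)+n\left(H_n(1)-\tfrac{1}{2}H_n(1)^2\right)+\tfrac{n}{2}H_n(2)-n.$$
   Context: For a vector $\mathbf{s}=(s_1,\dots,s_d)$ of positive integers and $n\geq 0$, the multiple harmonic sum is $H_n(\mathbf{s})=\sum_{1\leq k_1<k_2<\cdots<k_d\leq n}\frac{1}{k_1^{s_1}k_2^{s_2}\cdots k_d^{s_d}}$. Thus $H_n(1)=\sum_{k=1}^n 1/k$, $H_n(2)=\sum_{k=1}^n 1/k^2$, and $H_n(1,1,1)=\sum_{1\le i<j<l\le n}\frac{1}{ijl}$. -}

module Defs where

open import Data.Nat using (ℕ; zero; suc; _<ᵇ_)
open import Data.Bool using (if_then_else_)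
open import Data.List using (List; []; _∷_)
open import Data.Rational using (ℚ; 0ℚ; 1ℚ; _+_; _*_; _/_)
import Data.Nat as ℕ
open import Data.Nat.Properties using (m^n≢0)
import Data.Integer as ℤ

sumTo : ℕ → (ℕ → ℚ) → ℚ
sumTo zero    f = 0ℚ
sumTo (suc n) f = sumTo n f + f (suc n)

invPow : ℕ → ℕ → ℚ
invPow k s = _/_ (ℤ.+ 1) (suc k ℕ.^ s) {{m^n≢0 (suc k) s}}

-- Hfrom m n (s₁ ∷ … ∷ s_d ∷ []) = Σ_{m < k₁ < k₂ < ⋯ < k_d ≤ n} 1/(k₁^{s₁} ⋯ k_d^{s_d})
-- (the empty index list gives the empty product 1)
Hfrom : ℕ → ℕ → List ℕ → ℚ
Hfrom m n []       = 1ℚ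
Hfrom m n (s ∷ ss) =
  sumTo n (λ { zero → 0ℚ
             ; (suc j) → if m <ᵇ suc j
                           then invPow j s * Hfrom (suc j) n ss
                           else 0ℚ })

H : ℕ → List ℕ → ℚ
H n s = Hfrom 0 n s

ofℕ : ℕ → ℚ
ofℕ n = ℤ.+ n / 1

module Submission where

-- Write A n = H_n(1), D n = H_n(1,1), T n = H_n(1,1,1) and
-- x = 1/(n+1).  Passing from n to n+1 adds exactly the terms whose largest
-- index equals n+1, so every multiple harmonic sum satisfies the
-- "last-index" recurrence
--     H_{n+1}(s₁,…,s_d,t) = H_n(s₁,…,s_d,t) + H_n(s₁,…,s_d) / (n+1)^t,
-- which we prove once for arbitrary index lists.  Specialised to (1),
-- (2), (1,1) and (1,1,1) it gives A' = A + x, H'(2) = H(2) + x²,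
-- D' = D + A x and T' = T + D x.  From these, induction yields
--   (1) the stuffle identity D n = ½ A n² − ½ H_n(2), and
--   (2) Σ_{k≤n} T k = (n+1) T n + n A n − n D n − n, whose inductive step
--       is a ring identity modulo the single relation (n+1)·x = 1.
-- Substituting (1) into (2) is the theorem.

open import Defs
open import Data.Nat using (ℕ; zero; suc; _≥_; _≤_; _<ᵇ_; z≤n; s≤s)
import Data.Nat as ℕ
import Data.Nat.Properties as ℕ
open import Data.Bool using (Bool; true; false; if_then_else_)
import Data.Bool as Bool
open import Data.List using (List; []; _∷_; _++_)
open import Data.Rational using (ℚ; 0ℚ; 1ℚ; ½; _+_; _-_; _*_; fromℚᵘ)
open import Data.Rational.Properties
  using ( fromℚᵘ-cong; fromℚᵘ-toℚᵘ; toℚᵘ-fromℚᵘ; toℚᵘ-homo-+; toℚᵘ-homo-*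
        ; +-identityʳ; *-identityˡ; *-identityʳ; *-zeroˡ; *-zeroʳ; *-distribʳ-+)
import Data.Rational.Unnormalised as ℚᵘ
import Data.Rational.Unnormalised.Properties as ℚᵘ
import Data.Integer as ℤ
import Data.Integer.Solver
open import Data.Rational.Solver using (module +-*-Solver)
open +-*-Solver using (solve; _:=_; _:+_; _:*_; _:-_; con)
open import Relation.Nullary using (¬_)
open import Relation.Binary.PropositionalEquality
  using (_≡_; refl; sym; trans; cong; cong₂; module ≡-Reasoning)

-- Rational arithmetic.  `ofℕ` and `invPow` are normalisations of
-- unnormalised fractions, so their arithmetic is computed in ℚᵘ and
-- transported back along `fromℚᵘ`, which is a ring homomorphism.

fromℚᵘ-homo-+ : ∀ a b → fromℚᵘ a + fromℚᵘ b ≡ fromℚᵘ (a ℚᵘ.+ b)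
fromℚᵘ-homo-+ a b = trans (sym (fromℚᵘ-toℚᵘ _)) (fromℚᵘ-cong
  (ℚᵘ.≃-trans (toℚᵘ-homo-+ (fromℚᵘ a) (fromℚᵘ b))
              (ℚᵘ.+-cong (toℚᵘ-fromℚᵘ a) (toℚᵘ-fromℚᵘ b))))

fromℚᵘ-homo-* : ∀ a b → fromℚᵘ a * fromℚᵘ b ≡ fromℚᵘ (a ℚᵘ.* b)
fromℚᵘ-homo-* a b = trans (sym (fromℚᵘ-toℚᵘ _)) (fromℚᵘ-cong
  (ℚᵘ.≃-trans (toℚᵘ-homo-* (fromℚᵘ a) (fromℚᵘ b))
              (ℚᵘ.*-cong (toℚᵘ-fromℚᵘ a) (toℚᵘ-fromℚᵘ b))))

recip : ℕ → ℚ
recip n = invPow n 1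

ofℕ-suc : ∀ n → ofℕ (suc n) ≡ ofℕ n + 1ℚ
ofℕ-suc n = sym (trans (fromℚᵘ-homo-+ (ℚᵘ.mkℚᵘ (ℤ.+ n) 0) ℚᵘ.1ℚᵘ)
  (fromℚᵘ-cong {x = ℚᵘ.mkℚᵘ (ℤ.+ n) 0 ℚᵘ.+ ℚᵘ.1ℚᵘ} {y = ℚᵘ.mkℚᵘ (ℤ.+ suc n) 0}
     (ℚᵘ.*≡* (solve′ 1 (λ m → (m :*′ 1′ :+′ 1′ :*′ 1′) :*′ 1′
                                       :=′ (1′ :+′ m) :*′ (1′ :*′ 1′)) refl (ℤ.+ n)))))
  where
  open Data.Integer.Solver.+-*-Solver
    using () renaming (solve to solve′; _:=_ to _:=′_; _:+_ to _:+′_; _:*_ to _:*′_; con to con′)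
  1′ = con′ (ℤ.+ 1)

ofℕ-suc-*-recip : ∀ n → ofℕ (suc n) * recip n ≡ 1ℚ
ofℕ-suc-*-recip n =
  trans (fromℚᵘ-homo-* (ℚᵘ.mkℚᵘ (ℤ.+ suc n) 0) (ℚᵘ.mkℚᵘ (ℤ.+ 1) (n ℕ.* 1)))
        (fromℚᵘ-cong {x = ℚᵘ.mkℚᵘ (ℤ.+ suc n) 0 ℚᵘ.* ℚᵘ.mkℚᵘ (ℤ.+ 1) (n ℕ.* 1)}
                      {y = ℚᵘ.1ℚᵘ} (ℚᵘ.*≡* (cong (λ k → ℤ.+ suc k) n*1*1≡n*1+0+0)))
  where
  n*1*1≡n*1+0+0 : n ℕ.* 1 ℕ.* 1 ≡ n ℕ.* 1 ℕ.+ 0 ℕ.+ 0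
  n*1*1≡n*1+0+0 = trans (ℕ.*-identityʳ (n ℕ.* 1))
                        (sym (trans (ℕ.+-identityʳ _) (ℕ.+-identityʳ _)))

invPow-square : ∀ n → invPow n 2 ≡ recip n * recip n
invPow-square n =
  sym (trans (fromℚᵘ-homo-* (ℚᵘ.mkℚᵘ (ℤ.+ 1) (n ℕ.* 1)) (ℚᵘ.mkℚᵘ (ℤ.+ 1) (n ℕ.* 1)))
             (fromℚᵘ-cong {x = ℚᵘ.mkℚᵘ (ℤ.+ 1) (n ℕ.* 1) ℚᵘ.* ℚᵘ.mkℚᵘ (ℤ.+ 1) (n ℕ.* 1)}
                          {y = ℚᵘ.mkℚᵘ (ℤ.+ 1) (n ℕ.* 1 ℕ.+ n ℕ.* suc (n ℕ.* 1))}
                          (ℚᵘ.*≡* (denominators n))))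
  where
  denominators : ∀ n → (ℤ.+ 1 ℤ.* ℤ.+ 1) ℤ.* ℤ.+ suc (n ℕ.* 1 ℕ.+ n ℕ.* suc (n ℕ.* 1))
                     ≡ ℤ.+ 1 ℤ.* ℤ.+ suc (n ℕ.* 1 ℕ.+ (n ℕ.* 1) ℕ.* suc (n ℕ.* 1))
  denominators n rewrite ℕ.*-identityʳ n = refl

sumTo-cong : ∀ n {f g : ℕ → ℚ} → (∀ k → k ≤ n → f k ≡ g k) → sumTo n f ≡ sumTo n g
sumTo-cong zero    f≗g = refl
sumTo-cong (suc n) f≗g =
  cong₂ _+_ (sumTo-cong n (λ k k≤n → f≗g k (ℕ.m≤n⇒m≤1+n k≤n))) (f≗g (suc n) ℕ.≤-refl)

sumTo-+ : ∀ n (f g : ℕ → ℚ) → sumTo n (λ k → f k + g k) ≡ sumTo n f + sumTo n g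
sumTo-+ zero    f g = refl
sumTo-+ (suc n) f g = trans (cong (_+ (f (suc n) + g (suc n))) (sumTo-+ n f g))
  (solve 4 (λ a b c d → (a :+ b) :+ (c :+ d) := (a :+ c) :+ (b :+ d)) refl
     (sumTo n f) (sumTo n g) (f (suc n)) (g (suc n)))

sumTo-*ʳ : ∀ n (f : ℕ → ℚ) c → sumTo n (λ k → f k * c) ≡ sumTo n f * c
sumTo-*ʳ zero    f c = sym (*-zeroˡ c)
sumTo-*ʳ (suc n) f c = trans (cong (_+ (f (suc n) * c)) (sumTo-*ʳ n f c))
  (sym (*-distribʳ-+ c (sumTo n f) (f (suc n))))

sumTo-zero : ∀ n (f : ℕ → ℚ) → (∀ k → k ≤ n → f k ≡ 0ℚ) → sumTo n f ≡ 0ℚ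
sumTo-zero zero    f f≗0 = refl
sumTo-zero (suc n) f f≗0 =
  cong₂ _+_ (sumTo-zero n f (λ k k≤n → f≗0 k (ℕ.m≤n⇒m≤1+n k≤n))) (f≗0 (suc n) ℕ.≤-refl)

guard : Bool → ℚ → ℚ
guard b q = if b then q else 0ℚ

guard-true : ∀ {b} q → Bool.T b → guard b q ≡ q
guard-true {true} q _ = refl

guard-false : ∀ {b} q → ¬ Bool.T b → guard b q ≡ 0ℚ
guard-false {true}  q ¬b with () ← ¬b _
guard-false {false} q ¬b = refl

guard-zero : ∀ b {q} → q ≡ 0ℚ → guard b q ≡ 0ℚ
guard-zero false _   = refl
guard-zero true  q≡0 = q≡0

0≡0+0*x : ∀ x → 0ℚ ≡ 0ℚ + 0ℚ * x
0≡0+0*x x = sym (trans (cong (0ℚ +_) (*-zeroˡ x)) (+-identityʳ 0ℚ))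

-- A guarded product is linear in its second factor; this is how a
-- recurrence for the inner sums lifts through one layer of `Hfrom`.
guard-linear : ∀ b y {d′} d a x → d′ ≡ d + a * x →
               guard b (y * d′) ≡ guard b (y * d) + guard b (y * a) * x
guard-linear false y d a x _    = 0≡0+0*x x
guard-linear true  y d a x refl =
  solve 4 (λ y d a x → y :* (d :+ a :* x) := y :* d :+ (y :* a) :* x) refl y d a x

outerTerm : ℕ → ℕ → ℕ → List ℕ → ℕ → ℚ
outerTerm m n s ss zero    = 0ℚ
outerTerm m n s ss (suc j) = guard (m <ᵇ suc j) (invPow j s * Hfrom (suc j) n ss)

Hfrom-unfold : ∀ m n s ss → Hfrom m n (s ∷ ss) ≡ sumTo n (outerTerm m n s ss)
Hfrom-unfold m n s ss = sumTo-cong n λ { zero _ → refl ; (suc j) _ → refl }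

Hfrom-emptyRange : ∀ {m n} s ss → n ≤ m → Hfrom m n (s ∷ ss) ≡ 0ℚ
Hfrom-emptyRange {m} {n} s ss n≤m =
  trans (Hfrom-unfold m n s ss) (sumTo-zero n _ term≡0)
  where
  term≡0 : ∀ k → k ≤ n → outerTerm m n s ss k ≡ 0ℚ
  term≡0 zero    _   = refl
  term≡0 (suc j) k≤n =
    guard-false _ (λ m<k → ℕ.<⇒≱ (ℕ.<ᵇ⇒< m (suc j) m<k) (ℕ.≤-trans k≤n n≤m))

Hfrom-snoc-emptyRange : ∀ {m n} ss t → n ≤ m → Hfrom m n (ss ++ t ∷ []) ≡ 0ℚ
Hfrom-snoc-emptyRange []       t = Hfrom-emptyRange t []
Hfrom-snoc-emptyRange (s ∷ ss) t = Hfrom-emptyRange s (ss ++ t ∷ [])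

-- The last-index recurrence: the terms of Hfrom m (n+1) (ss ++ [t]) with
-- largest index n+1 sum to Hfrom m n ss / (n+1)^t.
Hfrom-snoc : ∀ m n ss t → m ≤ n →
  Hfrom m (suc n) (ss ++ t ∷ []) ≡ Hfrom m n (ss ++ t ∷ []) + Hfrom m n ss * invPow n t
Hfrom-snoc m n [] t m≤n = cong₂ _+_
  (sumTo-cong n λ { zero _ → refl ; (suc j) _ → refl })
  (trans (guard-true _ (ℕ.<⇒<ᵇ (s≤s m≤n)))
         (trans (*-identityʳ (invPow n t)) (sym (*-identityˡ (invPow n t)))))
Hfrom-snoc m n (s ∷ ss) t m≤n = begin
  Hfrom m (suc n) (s ∷ L)
    ≡⟨ Hfrom-unfold m (suc n) s L ⟩
  sumTo n (outerTerm m (suc n) s L) + outerTerm m (suc n) s L (suc n)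
    ≡⟨ cong₂ _+_ (sumTo-cong n termStep) lastTerm≡0 ⟩
  sumTo n (λ k → outerTerm m n s L k + outerTerm m n s ss k * x) + 0ℚ
    ≡⟨ +-identityʳ _ ⟩
  sumTo n (λ k → outerTerm m n s L k + outerTerm m n s ss k * x)
    ≡⟨ sumTo-+ n _ _ ⟩
  sumTo n (outerTerm m n s L) + sumTo n (λ k → outerTerm m n s ss k * x)
    ≡⟨ cong₂ _+_ (sym (Hfrom-unfold m n s L))
                 (trans (sumTo-*ʳ n _ x) (cong (_* x) (sym (Hfrom-unfold m n s ss)))) ⟩
  Hfrom m n (s ∷ L) + Hfrom m n (s ∷ ss) * x
    ∎
  where
  open ≡-Reasoning
  L = ss ++ t ∷ []
  x = invPow n t

  termStep : ∀ k → k ≤ n →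
    outerTerm m (suc n) s L k ≡ outerTerm m n s L k + outerTerm m n s ss k * x
  termStep zero    _   = 0≡0+0*x x
  termStep (suc j) k≤n =
    guard-linear (m <ᵇ suc j) (invPow j s) _ _ x (Hfrom-snoc (suc j) n ss t k≤n)

  lastTerm≡0 : outerTerm m (suc n) s L (suc n) ≡ 0ℚ
  lastTerm≡0 = guard-zero (m <ᵇ suc n)
    (trans (cong (invPow n s *_) (Hfrom-snoc-emptyRange ss t ℕ.≤-refl)) (*-zeroʳ (invPow n s)))

H-snoc : ∀ n ss t → H (suc n) (ss ++ t ∷ []) ≡ H n (ss ++ t ∷ []) + H n ss * invPow n t
H-snoc n ss t = Hfrom-snoc 0 n ss t z≤n

H1-step : ∀ n → H (suc n) (1 ∷ []) ≡ H n (1 ∷ []) + 1ℚ * recip n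
H1-step n = H-snoc n [] 1

H2-step : ∀ n → H (suc n) (2 ∷ []) ≡ H n (2 ∷ []) + 1ℚ * (recip n * recip n)
H2-step n = trans (H-snoc n [] 2) (cong (λ y → H n (2 ∷ []) + 1ℚ * y) (invPow-square n))

H11-step : ∀ n → H (suc n) (1 ∷ 1 ∷ []) ≡ H n (1 ∷ 1 ∷ []) + H n (1 ∷ []) * recip n
H11-step n = H-snoc n (1 ∷ []) 1

H111-step : ∀ n →
  H (suc n) (1 ∷ 1 ∷ 1 ∷ []) ≡ H n (1 ∷ 1 ∷ 1 ∷ []) + H n (1 ∷ 1 ∷ []) * recip n
H111-step n = H-snoc n (1 ∷ 1 ∷ []) 1

H11-stuffle : ∀ n → H n (1 ∷ 1 ∷ []) ≡ ½ * (H n (1 ∷ []) * H n (1 ∷ [])) - ½ * H n (2 ∷ [])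
H11-stuffle zero    = refl
H11-stuffle (suc n) = begin
  H (suc n) (1 ∷ 1 ∷ [])
    ≡⟨ H11-step n ⟩
  H n (1 ∷ 1 ∷ []) + A * x
    ≡⟨ cong (_+ A * x) (H11-stuffle n) ⟩
  (½ * (A * A) - ½ * B) + A * x
    ≡⟨ solve 3 (λ A B x → (con ½ :* (A :* A) :- con ½ :* B) :+ A :* x
                 := con ½ :* ((A :+ con 1ℚ :* x) :* (A :+ con 1ℚ :* x))
                    :- con ½ :* (B :+ con 1ℚ :* (x :* x))) refl A B x ⟩
  ½ * ((A + 1ℚ * x) * (A + 1ℚ * x)) - ½ * (B + 1ℚ * (x * x))
    ≡⟨ sym (cong₂ (λ a b → ½ * (a * a) - ½ * b) (H1-step n) (H2-step n)) ⟩
  ½ * (H (suc n) (1 ∷ []) * H (suc n) (1 ∷ [])) - ½ * H (suc n) (2 ∷ [])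
    ∎
  where
  open ≡-Reasoning
  x = recip n
  A = H n (1 ∷ [])
  B = H n (2 ∷ [])

-- The closed form (n+1) T + n A − n D − n, written for arbitrary values
-- M = n+1, N = n, T = H_n(1,1,1), A = H_n(1), D = H_n(1,1).
closedForm : ℚ → ℚ → ℚ → ℚ → ℚ → ℚ
closedForm M N T A D = M * T + N * A - N * D - N

-- The inductive step of the summation formula as an algebraic fact:
-- updating (N, T, A, D) by the recurrences raises the closed form by the
-- new summand T + D x, provided (N+1) x = 1.  The difference of the two
-- sides is (D + 1 − A)((N+1) x − 1).
closedForm-step : ∀ N T D A x → (N + 1ℚ) * x ≡ 1ℚ →
  closedForm ((N + 1ℚ) + 1ℚ) (N + 1ℚ) (T + D * x) (A + 1ℚ * x) (D + A * x)
    ≡ closedForm (N + 1ℚ) N T A D + (T + D * x)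
closedForm-step N T D A x [N+1]x≡1 = begin
  closedForm ((N + 1ℚ) + 1ℚ) (N + 1ℚ) (T + D * x) (A + 1ℚ * x) (D + A * x)
    ≡⟨ solve 5 (λ N T D A x →
         ((N :+ con 1ℚ) :+ con 1ℚ) :* (T :+ D :* x) :+ (N :+ con 1ℚ) :* (A :+ con 1ℚ :* x)
           :- (N :+ con 1ℚ) :* (D :+ A :* x) :- (N :+ con 1ℚ)
         := ((N :+ con 1ℚ) :* T :+ N :* A :- N :* D :- N) :+ (T :+ D :* x)
            :+ (D :+ con 1ℚ :- A) :* ((N :+ con 1ℚ) :* x :- con 1ℚ)) refl N T D A x ⟩
  rhs + (D + 1ℚ - A) * ((N + 1ℚ) * x - 1ℚ)
    ≡⟨ cong (λ y → rhs + (D + 1ℚ - A) * (y - 1ℚ)) [N+1]x≡1 ⟩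
  rhs + (D + 1ℚ - A) * (1ℚ - 1ℚ)
    ≡⟨ trans (cong (rhs +_) (*-zeroʳ (D + 1ℚ - A))) (+-identityʳ rhs) ⟩
  rhs
    ∎
  where
  open ≡-Reasoning
  rhs = closedForm (N + 1ℚ) N T A D + (T + D * x)

sum-H111 : ∀ n → sumTo n (λ k → H k (1 ∷ 1 ∷ 1 ∷ []))
               ≡ closedForm (ofℕ (suc n)) (ofℕ n) (H n (1 ∷ 1 ∷ 1 ∷ []))
                            (H n (1 ∷ [])) (H n (1 ∷ 1 ∷ []))
sum-H111 zero    = refl
sum-H111 (suc n) = begin
  sumTo n (λ k → H k (1 ∷ 1 ∷ 1 ∷ [])) + H (suc n) (1 ∷ 1 ∷ 1 ∷ [])
    ≡⟨ cong₂ _+_ (sum-H111 n) (H111-step n) ⟩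
  closedForm (ofℕ (suc n)) N T A D + (T + D * x)
    ≡⟨ cong (λ M → closedForm M N T A D + (T + D * x)) (ofℕ-suc n) ⟩
  closedForm (N + 1ℚ) N T A D + (T + D * x)
    ≡⟨ sym (closedForm-step N T D A x
              (trans (cong (_* x) (sym (ofℕ-suc n))) (ofℕ-suc-*-recip n))) ⟩
  closedForm ((N + 1ℚ) + 1ℚ) (N + 1ℚ) (T + D * x) (A + 1ℚ * x) (D + A * x)
    ≡⟨ sym (updated (trans (ofℕ-suc (suc n)) (cong (_+ 1ℚ) (ofℕ-suc n))) (ofℕ-suc n)
                    (H111-step n) (H1-step n) (H11-step n)) ⟩
  closedForm (ofℕ (suc (suc n))) (ofℕ (suc n)) (H (suc n) (1 ∷ 1 ∷ 1 ∷ []))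
             (H (suc n) (1 ∷ [])) (H (suc n) (1 ∷ 1 ∷ []))
    ∎
  where
  open ≡-Reasoning
  x = recip n
  N = ofℕ n
  T = H n (1 ∷ 1 ∷ 1 ∷ [])
  A = H n (1 ∷ [])
  D = H n (1 ∷ 1 ∷ [])
  updated : ∀ {M M′ N N′ T T′ A A′ D D′} → M ≡ M′ → N ≡ N′ → T ≡ T′ → A ≡ A′ → D ≡ D′ →
            closedForm M N T A D ≡ closedForm M′ N′ T′ A′ D′
  updated refl refl refl refl refl = refl

mainTheorem4 : (n : ℕ) → n ≥ 1 →
    sumTo n (λ k → H k (1 ∷ 1 ∷ 1 ∷ []))
      ≡ ofℕ (suc n) * H n (1 ∷ 1 ∷ 1 ∷ [])
        + ofℕ n * (H n (1 ∷ []) - ½ * (H n (1 ∷ []) * H n (1 ∷ [])))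
        + ½ * ofℕ n * H n (2 ∷ [])
        - ofℕ n
mainTheorem4 n _ = begin
  sumTo n (λ k → H k (1 ∷ 1 ∷ 1 ∷ []))
    ≡⟨ sum-H111 n ⟩
  closedForm M N T A (H n (1 ∷ 1 ∷ []))
    ≡⟨ cong (closedForm M N T A) (H11-stuffle n) ⟩
  closedForm M N T A (½ * (A * A) - ½ * B)
    ≡⟨ solve 5 (λ M N T A B →
         M :* T :+ N :* A :- N :* (con ½ :* (A :* A) :- con ½ :* B) :- N
         := M :* T :+ N :* (A :- con ½ :* (A :* A)) :+ con ½ :* N :* B :- N) refl M N T A B ⟩
  M * T + N * (A - ½ * (A * A)) + ½ * N * B - N
    ∎
  where
  open ≡-Reasoning
  M = ofℕ (suc n)
  N = ofℕ n
  T = H n (1 ∷ 1 ∷ 1 ∷ [])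
  A = H n (1 ∷ [])
  B = H n (2 ∷ [])
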